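{- Every $IEL^-$-frame is an $E5L5^-$-frame (without designated maximal world), and every $IEL$-frame is an $E5L5$-frame (without designated maximal world).
   Context: A frame is a tuple $(W,R,P,E)$: $W$ nonempty; $R$ a partial order on $W$ with least element $w_\bot$ in which every chain has an upper bound; $R(w):=\{w': wRw'\}$; $Max(W)$ the set of $R$-maximal elements; $P$ a set of $R$-upward closed subsets of $W$; $E:W\to\mathcal P(P)$ with each $E(w)$ a filter on $P$ (nonempty, closed under $\cap$, and $A\in E(w)$, $A\subseteq B\in P$ imply $B\in E(w)$) and $wRw'\Rightarrow E(w)\subseteq E(w')$; $\varnothing,W\in P$ and $P$ closed under $\cap$, $\cup$, $A\supset B:=\{w:\forall w'\in R(w)(w'\in A\Rightarrow w'\in B)\}$, $KA:=\{w: A\in E(w)\}$. (This is an $EL5^-$-frame without designated maximal world.) It is an $E4L5^-$-frame if $A\in E(w)$ implies $\{w': A\in E(w')\}\in E(w)$; an $E5L5^-$-frame if it is $E4L5^-$ and, whenever $A\notin E(w')$ for all $w'\in R(w)$, $(\{w'': A\in E(w'')\}\supset\varnothing)\in E(w)$. The "plus" versions ($EL5$-, $E5L5$-frames) additionally satisfy $Max(W)\cap R(w)\subseteq A$ for all $w$ and all $A\in E(w)$. An $IEL^-$-frame (resp. $IEL$-frame) is such a frame (resp. such a frame satisfying the $Max(W)$ condition) that additionally satisfies (IntCo): for all $w\in W$ and $A\in P$, $w\in A$ implies $A\in E(w)$. -}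

module Defs where

open import Data.Product using (Σ; _×_; _,_)
open import Data.Sum using (_⊎_)
open import Data.Empty using (⊥)
open import Relation.Nullary using (¬_)
open import Relation.Binary.PropositionalEquality using (_≡_)

Subset : Set → Set₁
Subset W = W → Set

module _ {W : Set} where

  _⊆_ : Subset W → Subset W → Set
  A ⊆ B = ∀ w → A w → B w

  _∩_ : Subset W → Subset W → Subset W
  (A ∩ B) w = A w × B w

  _∪_ : Subset W → Subset W → Subset W
  (A ∪ B) w = A w ⊎ B w

  ∅ : Subset W
  ∅ _ = ⊥

  Full : Subset W
  Full _ = W

  UpClosed : (W → W → Set) → Subset W → Set
  UpClosed R A = ∀ w w' → R w w' → A w → A w'

  Imp : (W → W → Set) → Subset W → Subset W → Subset W
  Imp R A B w = ∀ w' → R w w' → A w' → B w'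

  Kop : (W → Subset W → Set) → Subset W → Subset W
  Kop E A w = E w A

  IsChain : (W → W → Set) → Subset W → Set
  IsChain R C = ∀ x y → C x → C y → R x y ⊎ R y x

  IsMax : (W → W → Set) → W → Set
  IsMax R w = ∀ w' → R w w' → w' ≡ w

-- EL5⁻-frame (without designated maximal world)
record Frame : Set₁ where
  field
    W : Set
    R : W → W → Set
    R-refl    : ∀ w → R w w
    R-trans   : ∀ u v w → R u v → R v w → R u w
    R-antisym : ∀ u v → R u v → R v u → u ≡ v
    w⊥       : W
    w⊥-least : ∀ w → R w⊥ w
    chain-ub : ∀ (C : Subset W) → IsChain R C → Σ W (λ u → ∀ x → C x → R x u)
    -- P: a set of R-upward closed subsets (sets = extensional predicates)
    P        : Subset W → Set
    P-ext    : ∀ A B → A ⊆ B → B ⊆ A → P A → P B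
    P-up     : ∀ A → P A → UpClosed R A
    E        : W → Subset W → Set
    E⊆P      : ∀ w A → E w A → P A
    E-inhab  : ∀ w → Σ (Subset W) (E w)
    E-∩      : ∀ w A B → E w A → E w B → E w (A ∩ B)
    E-up     : ∀ w A B → E w A → A ⊆ B → P B → E w B
    E-mono   : ∀ w w' A → R w w' → E w A → E w' A
    P-∅      : P ∅
    P-W      : P Full
    P-∩      : ∀ A B → P A → P B → P (A ∩ B)
    P-∪      : ∀ A B → P A → P B → P (A ∪ B)
    P-⊃      : ∀ A B → P A → P B → P (Imp R A B)
    P-K      : ∀ A → P A → P (Kop E A)

module _ (F : Frame) where
  open Frame F

  IsE4 : Set₁
  IsE4 = ∀ w A → E w A → E w (Kop E A)

  IsE5 : Set₁
  IsE5 = IsE4 × (∀ w A → P A → (∀ w' → R w w' → ¬ E w' A) → E w (Imp R (Kop E A) ∅))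

  -- "plus" condition: Max(W) ∩ R(w) ⊆ A for all A ∈ E(w)
  MaxCond : Set₁
  MaxCond = ∀ w A → E w A → ∀ w' → R w w' → IsMax R w' → A w'

  IntCo : Set₁
  IntCo = ∀ w A → P A → A w → E w A

module Submission where

open import Defs
open import Data.Product using (_×_; _,_)
open import Relation.Nullary using (¬_)

-- Under (IntCo) a set of P holding at w already belongs to E(w), so both
-- conditions reduce to the closure of P under K and ⊃ together with the fact
-- that KA ⊃ ∅ holds at w exactly when A ∉ E(w') for every w' ∈ R(w).

module _ (F : Frame) (intCo : IntCo F) where
  open Frame F

  IntCo⇒IsE4 : IsE4 F
  IntCo⇒IsE4 w A A∈Ew = intCo w (Kop E A) (P-K A (E⊆P w A A∈Ew)) A∈Ew

  IntCo⇒IsE5 : IsE5 F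
  IntCo⇒IsE5 = IntCo⇒IsE4 , ¬K⇒E-¬K
    where
    ¬K⇒E-¬K : ∀ w A → P A → (∀ w' → R w w' → ¬ E w' A) → E w (Imp R (Kop E A) ∅)
    ¬K⇒E-¬K w A pA A∉E = intCo w (Imp R (Kop E A) ∅) (P-⊃ (Kop E A) ∅ (P-K A pA) P-∅) A∉E

lemma5p2 : ((F : Frame) → IntCo F → IsE5 F)
    × ((F : Frame) → IntCo F → MaxCond F → IsE5 F × MaxCond F)
lemma5p2 = IntCo⇒IsE5 , λ F intCo maxCond → IntCo⇒IsE5 F intCo , maxCond
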